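{- Let $x$ be a node of a top tree in which all clusters are valid and the orientation invariant holds. If $\mathrm{semi\_splay\_step}(x)$ returns null, then no change was made to the tree and $\mathrm{depth}(x) \leq 4$. Moreover, in that case: if $x$ is a point cluster then $\mathrm{depth}(x) \leq 3$; if the root is a point cluster then $\mathrm{depth}(x) \leq 2$; and if both $x$ and the root are point clusters then $\mathrm{depth}(x) \leq 1$.
   Context: Let $F$ be a forest (the underlying forest) in which some vertices are marked as exposed. For a set $C$ of edges of $F$, a vertex $w$ is a boundary vertex of $C$ if $w$ is incident to an edge of $C$ and either $w$ is exposed or $w$ is incident to an edge of $F$ not in $C$. A cluster is a nonempty connected set of edges; it is valid if it has at most two boundary vertices; a valid cluster is a path cluster if it has exactly two boundary vertices and a point cluster if it has zero or one. A top tree for a tree $T$ of $F$ (with at least one edge) is a rooted tree in which every internal node has exactly two children and whose leaves are in bijection with the edges of $T$; each node is identified with the cluster of edges at the leaves of its subtree, every such cluster being connected and valid. The two children of an internal node share exactly one vertex, its central vertex. The depth of a node is its distance to the root (the root has depth $0$). Orientation: each internal node has ordered children (left, right), each leaf has ordered endpoints (left, right). For a leaf, a boundary vertex is its left/right boundary vertex if it is its left/right endpoint; for an internal node, a boundary vertex is middle if it equals the central vertex, and otherwise left/right according to whether it is a boundary vertex of the left/right child. Leftmost boundary vertex: the left one if it exists, else the middle one if it exists, else none; rightmost symmetric. Orientation invariant: for every internal node, the rightmost boundary vertex of the left child and the leftmost boundary vertex of the right child exist and equal the central vertex. Two nodes hang off to the same side if both are left children or both are right children of their respective parents. Rotation: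 for a node $u$ with parent $y$ and grandparent $z$, with $a=\mathrm{sibling}(u)$, $b=\mathrm{sibling}(y)$, $\mathrm{rotate\_up}(u)$ is allowed iff $a\cup b$ is a valid cluster; it makes $a,b$ the children of $y$ and $u,y$ the children of $z$ (other parent–child relations unchanged), then adjusts child orders and orientations (possibly reversing orientations of whole subtrees) so that the orientation invariant holds. Semi-splay step: $\mathrm{semi\_splay\_step}(x)$ does the following. Let $p$ be the parent and $g$ the grandparent of $x$; if either does not exist, return null without changes. If $x$ and $g$ are both point clusters, perform $\mathrm{rotate\_up}(x)$ and return $g$. Otherwise let $gg$ be the parent of $g$; if it does not exist, return null. If $p$ is a path cluster and ($g$ is a path cluster or $gg$ is a point cluster), then: if $x$ and $p$ hang off to the same side, perform $\mathrm{rotate\_up}(x)$ and return $g$; else if $p$ and $g$ hang off to the same side, perform $\mathrm{rotate\_up}(p)$ and return $gg$; else (then $x$ and $g$ hang off to the same side) perform $\mathrm{rotate\_up}(\mathrm{sibling}(x))$ followed by $\mathrm{rotate\_up}(p)$ and return $gg$. In all remaining cases, return $\mathrm{semi\_splay\_step}(p)$. -}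

module Defs where

open import Data.Nat using (ℕ; _≤_; _≡ᵇ_; _≤ᵇ_)
open import Data.Bool using (Bool; true; false; _∧_; _∨_; not; if_then_else_)
open import Data.Bool.ListAction using (any)
open import Data.List using (List; []; _∷_; length; reverse; filterᵇ; deduplicateᵇ; removeAt; lookup)
open import Data.List.Membership.Propositional using (_∈_)
open import Data.List.Relation.Unary.All using (All)
open import Data.List.Relation.Unary.Any using (Any)
open import Data.List.Relation.Unary.AllPairs using (AllPairs)
open import Data.Maybe using (Maybe; just; nothing; _<∣>_)
open import Data.Fin using (Fin)
open import Data.Product using (_×_; _,_; Σ; proj₁; proj₂)
open import Data.Sum using (_⊎_)
open import Relation.Binary.PropositionalEquality using (_≡_; _≢_)
open import Relation.Nullary using (¬_)

-- An edge of the forest is an unordered pair; the same pair stored as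
-- (a , b) at a leaf of a top tree is the leaf's (left , right) endpoints.

Edge : Set
Edge = ℕ × ℕ

Incident : ℕ → Edge → Set
Incident w e = (w ≡ proj₁ e) ⊎ (w ≡ proj₂ e)

SameEdge : Edge → Edge → Set
SameEdge e e' = (proj₁ e ≡ proj₁ e' × proj₂ e ≡ proj₂ e')
              ⊎ (proj₁ e ≡ proj₂ e' × proj₂ e ≡ proj₁ e')

SharesVertex : Edge → Edge → Set
SharesVertex e e' = Σ ℕ λ w → Incident w e × Incident w e'

data VReach (E : List Edge) : ℕ → ℕ → Set where
  here  : ∀ {u} → VReach E u u
  fwd   : ∀ {u a b} → (a , b) ∈ E → VReach E u a → VReach E u b
  bwd   : ∀ {u a b} → (a , b) ∈ E → VReach E u b → VReach E u a

-- A forest: no loops, and no edge lies on a cycle, i.e. the endpoints of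
-- each edge are disconnected once that edge is removed.
IsForest : List Edge → Set
IsForest F = All (λ e → proj₁ e ≢ proj₂ e) F
           × ((i : Fin (length F)) →
                ¬ VReach (removeAt F i) (proj₁ (lookup F i)) (proj₂ (lookup F i)))

data EReach (C : List Edge) (e : Edge) : Edge → Set where
  here : EReach C e e
  step : ∀ {e' e''} → e'' ∈ C → SharesVertex e' e'' → EReach C e e' → EReach C e e''

Connected : List Edge → Set
Connected C = ∀ {e e'} → e ∈ C → e' ∈ C → EReach C e e'

incidentᵇ : ℕ → Edge → Bool
incidentᵇ w (a , b) = (w ≡ᵇ a) ∨ (w ≡ᵇ b)

sameEdgeᵇ : Edge → Edge → Bool
sameEdgeᵇ (a , b) (c , d) = ((a ≡ᵇ c) ∧ (b ≡ᵇ d)) ∨ ((a ≡ᵇ d) ∧ (b ≡ᵇ c))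

memEᵇ : Edge → List Edge → Bool
memEᵇ e C = any (sameEdgeᵇ e) C

elemᵇ : ℕ → List ℕ → Bool
elemᵇ v vs = any (v ≡ᵇ_) vs

verts : List Edge → List ℕ
verts [] = []
verts ((a , b) ∷ es) = a ∷ b ∷ verts es

findᵇ : (ℕ → Bool) → List ℕ → Maybe ℕ
findᵇ p [] = nothing
findᵇ p (v ∷ vs) = if p v then just v else findᵇ p vs

data TT : Set where
  leaf : ℕ → ℕ → TT
  node : TT → TT → TT

leaves : TT → List Edge
leaves (leaf a b) = (a , b) ∷ []
leaves (node l r) = Data.List._++_ (leaves l) (leaves r)

data Dir : Set where
  L R : Dir

flipD : Dir → Dir
flipD L = R
flipD R = L

sameᵇ : Dir → Dir → Bool
sameᵇ L L = true
sameᵇ R R = true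
sameᵇ _ _ = false

-- A node is named by its position: the list of directions read from the
-- node up to the root.  (d ∷ p) is the d-child of the node at position p;
-- [] is the root.
Pos : Set
Pos = List Dir

depth : Pos → ℕ
depth = length

sibling : Pos → Pos
sibling [] = []
sibling (d ∷ p) = flipD d ∷ p

subRF : TT → List Dir → Maybe TT      -- root-first path
subRF t [] = just t
subRF (leaf _ _) (_ ∷ _) = nothing
subRF (node l r) (L ∷ ds) = subRF l ds
subRF (node l r) (R ∷ ds) = subRF r ds

sub : TT → Pos → Maybe TT
sub t p = subRF t (reverse p)

IsNode : TT → Pos → Set
IsNode t x = Σ TT λ s → sub t x ≡ just s

-- Clusters relative to the underlying forest F and exposed vertices ex.

module _ (F : List Edge) (ex : ℕ → Bool) where

  isBoundaryᵇ : List Edge → ℕ → Bool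
  isBoundaryᵇ C w = any (incidentᵇ w) C
                  ∧ (ex w ∨ any (λ e → incidentᵇ w e ∧ not (memEᵇ e C)) F)

  boundary : List Edge → List ℕ
  boundary C = deduplicateᵇ _≡ᵇ_ (filterᵇ (isBoundaryᵇ C) (verts C))

  bnd : TT → List ℕ
  bnd s = boundary (leaves s)

  nbd : TT → ℕ
  nbd s = length (bnd s)

  Valid : TT → Set
  Valid s = nbd s ≤ 2

  PointCluster : TT → Set
  PointCluster s = nbd s ≤ 1

  PathCluster : TT → Set
  PathCluster s = nbd s ≡ 2

  pointᵇ : TT → Bool
  pointᵇ s = nbd s ≤ᵇ 1

  pathᵇ : TT → Bool
  pathᵇ s = nbd s ≡ᵇ 2

  -- the central vertex: the (unique, in a forest) vertex shared by the children
  central : TT → TT → Maybe ℕ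
  central a b = findᵇ (λ v → elemᵇ v (verts (leaves b))) (verts (leaves a))

  leftBV : TT → Maybe ℕ
  leftBV (leaf l r) = if elemᵇ l (bnd (leaf l r)) then just l else nothing
  leftBV (node a b) with central a b
  ... | nothing = nothing
  ... | just c  = findᵇ (λ w → not (w ≡ᵇ c) ∧ elemᵇ w (bnd a)) (bnd (node a b))

  rightBV : TT → Maybe ℕ
  rightBV (leaf l r) = if elemᵇ r (bnd (leaf l r)) then just r else nothing
  rightBV (node a b) with central a b
  ... | nothing = nothing
  ... | just c  = findᵇ (λ w → not (w ≡ᵇ c) ∧ elemᵇ w (bnd b)) (bnd (node a b))

  middleBV : TT → Maybe ℕ
  middleBV (leaf _ _) = nothing
  middleBV (node a b) with central a b
  ... | nothing = nothing
  ... | just c  = if elemᵇ c (bnd (node a b)) then just c else nothing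

  leftmost : TT → Maybe ℕ
  leftmost s = leftBV s <∣> middleBV s

  rightmost : TT → Maybe ℕ
  rightmost s = rightBV s <∣> middleBV s

  -- t is a top tree (all clusters connected and valid) for a tree T of F:
  -- its leaves are edges of F, pairwise distinct, and the edge set T of the
  -- leaves is a whole connected component of F (closed under adjacency in F;
  -- connectedness is the connectedness of the root cluster).
  TopTreeOf : TT → Set
  TopTreeOf t =
      All (λ l → Any (SameEdge l) F) (leaves t)
    × AllPairs (λ e e' → ¬ SameEdge e e') (leaves t)
    × (∀ {e l} → e ∈ F → l ∈ leaves t → SharesVertex e l → Any (SameEdge e) (leaves t))
    × (∀ p s → sub t p ≡ just s → Connected (leaves s) × Valid s)

  OrientationInvariant : TT → Set
  OrientationInvariant t = ∀ p a b → sub t p ≡ just (node a b) →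
    Σ ℕ λ c → central a b ≡ just c × rightmost a ≡ just c × leftmost b ≡ just c

  -- The step is modelled by what it does: either it
  -- returns null (and performs no rotation), or it performs a list of
  -- rotate_up operations (nodes named by their positions before the step)
  -- and returns a node.

  data Result : Set where
    null : Result
    ret  : List Pos → Pos → Result

  rotations : Result → List Pos
  rotations null = []
  rotations (ret rs _) = rs

  module _ (t : TT) where
    pointAt : Pos → Bool
    pointAt p with sub t p
    ... | nothing = false
    ... | just s  = pointᵇ s

    pathAt : Pos → Bool
    pathAt p with sub t p
    ... | nothing = false
    ... | just s  = pathᵇ s

    semiSplayStep : Pos → Result
    semiSplayStep [] = null
    semiSplayStep (d ∷ []) = null
    semiSplayStep (d ∷ e ∷ []) =
      if pointAt (d ∷ e ∷ []) ∧ pointAt [] then ret ((d ∷ e ∷ []) ∷ []) [] else null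
    semiSplayStep (d ∷ e ∷ f ∷ gg) =
      let x = d ∷ e ∷ f ∷ gg ; p = e ∷ f ∷ gg ; g = f ∷ gg in
      if pointAt x ∧ pointAt g then ret (x ∷ []) g
      else if pathAt p ∧ (pathAt g ∨ pointAt gg)
        then (if sameᵇ d e then ret (x ∷ []) g
              else if sameᵇ e f then ret (p ∷ []) gg
              else ret (sibling x ∷ p ∷ []) gg)
        else semiSplayStep p

{-# OPTIONS --safe #-}
-- Label the nodes on the path from x up to the root by whether they are
-- point clusters; validity makes "path" the negation of "point".  A null
-- return means every guard of semi_splay_step failed on the way up: no node
-- on the path and its grandparent are both point clusters, and every proper
-- ancestor of x of depth at least 2 that is a path cluster has a point-cluster
-- parent and a path-cluster grandparent.  Chasing these local constraints
-- gives a path-cluster root once x has depth 3, a path-cluster x once it has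
-- depth 4, and a contradiction at depth 5.
module Submission where

open import Defs
open import Data.Nat using (ℕ; _+_; _≤_; z≤n; s≤s; zero; suc; _≤ᵇ_; _≡ᵇ_)
open import Data.Nat.Properties using (≤-refl; ≤⇒≤ᵇ)
open import Data.Bool using (Bool; true; false; _∧_; _∨_; not; if_then_else_)
open import Data.Bool.Properties using (T-≡; not-¬)
open import Data.List using (List; []; _∷_; _++_; length; reverse)
open import Data.List.Properties using (unfold-reverse)
open import Data.Maybe using (just)
open import Data.Product using (_×_; _,_; Σ; proj₁; proj₂)
open import Data.Empty using (⊥-elim)
open import Function.Bundles using (Equivalence)
open import Relation.Nullary using (¬_; contradiction)
open import Relation.Binary.PropositionalEquality
  using (_≡_; _≢_; refl; cong; subst; subst₂)

∧≡false⇒ : ∀ {a b} → (a ∧ b) ≡ false → a ≡ true → b ≡ false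
∧≡false⇒ h refl = h

not∧[not∨]≡false⇒ : ∀ {a b c} → (not a ∧ (not b ∨ c)) ≡ false → a ≡ false →
  b ≡ true × c ≡ false
not∧[not∨]≡false⇒ {b = true} h refl = refl , h
not∧[not∨]≡false⇒ {b = false} () refl

contraposeᵇ : ∀ {a b} → (a ≡ true → b ≡ false) → b ≡ true → a ≡ false
contraposeᵇ {false} _ _ = refl
contraposeᵇ {true} f refl = f refl

-- Stuck (b₀ ∷ b₁ ∷ … ∷ bₙ) r: bᵢ says whether the ancestor i levels above a
-- node of depth n is a point cluster (bₙ = r being the root), and with
-- "path = not point" these labels make every guard of semi_splay_step fail.
data Stuck : List Bool → Bool → Set where
  depth0 : ∀ {r} → Stuck (r ∷ []) r
  depth1 : ∀ {b₀ r} → Stuck (b₀ ∷ r ∷ []) r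
  depth2 : ∀ {b₀ b₁ r} → (b₀ ≡ true → r ≡ false) → Stuck (b₀ ∷ b₁ ∷ r ∷ []) r
  deeper : ∀ {b₀ b₁ b₂ b₃ bs r} →
    (b₀ ≡ true → b₂ ≡ false) → (b₁ ≡ false → b₂ ≡ true × b₃ ≡ false) →
    Stuck (b₁ ∷ b₂ ∷ b₃ ∷ bs) r → Stuck (b₀ ∷ b₁ ∷ b₂ ∷ b₃ ∷ bs) r

Stuck⇒root-path : ∀ {b₀ b₁ b₂ b₃ bs r} → Stuck (b₀ ∷ b₁ ∷ b₂ ∷ b₃ ∷ bs) r → r ≡ false
Stuck⇒root-path (deeper _ _ s@(deeper _ _ _)) = Stuck⇒root-path s
Stuck⇒root-path {b₁ = true} (deeper _ _ (depth2 below-point)) = below-point refl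
Stuck⇒root-path {b₁ = false} (deeper _ below-path (depth2 _)) = proj₂ (below-path refl)

Stuck⇒path : ∀ {b₀ b₁ b₂ b₃ b₄ bs r} → Stuck (b₀ ∷ b₁ ∷ b₂ ∷ b₃ ∷ b₄ ∷ bs) r → b₀ ≡ false
Stuck⇒path {b₀ = false} _ = refl
Stuck⇒path {b₀ = true} (deeper below-point₀ below-path₀ (deeper below-point₁ below-path₁ _)) =
  let b₂≡false = below-point₀ refl
      b₃≡true = proj₁ (below-path₁ b₂≡false)
      b₂≡true = proj₁ (below-path₀ (contraposeᵇ below-point₁ b₃≡true))
  in contradiction b₂≡true (not-¬ b₂≡false)

¬Stuck-depth≥5 : ∀ {b₀ b₁ b₂ b₃ b₄ b₅ bs r} → ¬ Stuck (b₀ ∷ b₁ ∷ b₂ ∷ b₃ ∷ b₄ ∷ b₅ ∷ bs) r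
¬Stuck-depth≥5 (deeper _ below-path₀ s@(deeper _ _ (deeper below-point₂ below-path₂ _))) =
  let b₂≡true , b₃≡false = below-path₀ (Stuck⇒path s)
      b₄≡true = proj₁ (below-path₂ b₃≡false)
  in contradiction b₄≡true (not-¬ (below-point₂ b₂≡true))

DepthBounds : ℕ → Bool → Bool → Set
DepthBounds n b r =
  n ≤ 4 × (b ≡ true → n ≤ 3) × (r ≡ true → n ≤ 2) × (b ≡ true → r ≡ true → n ≤ 1)

Stuck⇒DepthBounds : ∀ {b bs r} → Stuck (b ∷ bs) r → DepthBounds (length bs) b r
Stuck⇒DepthBounds depth0 = z≤n , (λ _ → z≤n) , (λ _ → z≤n) , λ _ _ → z≤n
Stuck⇒DepthBounds depth1 = s≤s z≤n , (λ _ → s≤s z≤n) , (λ _ → s≤s z≤n) , λ _ _ → s≤s z≤n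
Stuck⇒DepthBounds (depth2 not-both) =
  2≤ , (λ _ → 2≤) , (λ _ → 2≤) ,
  λ b≡true r≡true → contradiction r≡true (not-¬ (not-both b≡true))
  where
  2≤ : ∀ {n} → 2 ≤ 2 + n
  2≤ = s≤s (s≤s z≤n)
Stuck⇒DepthBounds s@(deeper _ _ (depth2 _)) =
  3≤ , (λ _ → 3≤) , (λ r≡true → contradiction r≡true root-path) ,
  λ _ r≡true → contradiction r≡true root-path
  where
  3≤ : ∀ {n} → 3 ≤ 3 + n
  3≤ = s≤s (s≤s (s≤s z≤n))
  root-path = not-¬ (Stuck⇒root-path s)
Stuck⇒DepthBounds s@(deeper _ _ (deeper _ _ (depth2 _))) =
  ≤-refl , (λ b≡true → contradiction b≡true x-path) ,
  (λ r≡true → contradiction r≡true root-path) , λ _ r≡true → contradiction r≡true root-path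
  where
  x-path = not-¬ (Stuck⇒path s)
  root-path = not-¬ (Stuck⇒root-path s)
Stuck⇒DepthBounds s@(deeper _ _ (deeper _ _ (deeper _ _ _))) = contradiction s ¬Stuck-depth≥5

subRF-prefix : ∀ t ps qs {s} → subRF t (ps ++ qs) ≡ just s → Σ TT λ s′ → subRF t ps ≡ just s′
subRF-prefix t [] qs _ = t , refl
subRF-prefix (node l r) (L ∷ ps) qs h = subRF-prefix l ps qs h
subRF-prefix (node l r) (R ∷ ps) qs h = subRF-prefix r ps qs h

IsNode-parent : ∀ {t} d p → IsNode t (d ∷ p) → IsNode t p
IsNode-parent {t} d p (s , h) =
  subRF-prefix t (reverse p) (d ∷ []) (subst (λ ds → subRF t ds ≡ just s) (unfold-reverse d p) h)

guard≡false : ∀ {F ex c} {a b : Result F ex} → a ≢ null → (if c then a else b) ≡ null →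
  c ≡ false × b ≡ null
guard≡false {c = false} _ h = refl , h
guard≡false {c = true} a≢null h = ⊥-elim (a≢null h)

rotation-branches≢null : ∀ {F : List Edge} {ex : ℕ → Bool} c c′ {rs g rs′ g′ rs″ g″} →
  (if c then ret {F} {ex} rs g else if c′ then ret rs′ g′ else ret rs″ g″) ≢ null
rotation-branches≢null true _ ()
rotation-branches≢null false true ()
rotation-branches≢null false false ()

semiSplayStep≡null-guards : ∀ {F ex t} d e f gg →
  let P = pointAt F ex t ; Q = pathAt F ex t
      x = d ∷ e ∷ f ∷ gg ; p = e ∷ f ∷ gg ; g = f ∷ gg in
  semiSplayStep F ex t x ≡ null →
  (P x ∧ P g) ≡ false × (Q p ∧ (Q g ∨ P gg)) ≡ false × semiSplayStep F ex t p ≡ null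
semiSplayStep≡null-guards {F} {ex} d e f gg h =
  let not-both , h′ = guard≡false (λ ()) h
      no-rotation , h″ = guard≡false (rotation-branches≢null {F} {ex} (sameᵇ d e) (sameᵇ e f)) h′
  in not-both , no-rotation , h″

module _ (F : List Edge) (ex : ℕ → Bool) (t : TT) where

  pointAt≡true : ∀ q {s} → sub t q ≡ just s → PointCluster F ex s → pointAt F ex t q ≡ true
  pointAt≡true q q↦s point rewrite q↦s = Equivalence.to T-≡ (≤⇒≤ᵇ point)

  ancestorPoints : Pos → List Bool
  ancestorPoints [] = []
  ancestorPoints (_ ∷ p) = pointAt F ex t p ∷ ancestorPoints p

  length-ancestorPoints : ∀ x → length (ancestorPoints x) ≡ depth x
  length-ancestorPoints [] = refl
  length-ancestorPoints (_ ∷ p) = cong suc (length-ancestorPoints p)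

  module _ (valid : ∀ p s → sub t p ≡ just s → Valid F ex s) where

    pathAt≡not-pointAt : ∀ q → IsNode t q → pathAt F ex t q ≡ not (pointAt F ex t q)
    pathAt≡not-pointAt q (s , q↦s) rewrite q↦s = n≤2⇒[n≡ᵇ2]≡not[n≤ᵇ1] (nbd F ex s) (valid q s q↦s)
      where
      n≤2⇒[n≡ᵇ2]≡not[n≤ᵇ1] : ∀ n → n ≤ 2 → (n ≡ᵇ 2) ≡ not (n ≤ᵇ 1)
      n≤2⇒[n≡ᵇ2]≡not[n≤ᵇ1] zero _ = refl
      n≤2⇒[n≡ᵇ2]≡not[n≤ᵇ1] (suc zero) _ = refl
      n≤2⇒[n≡ᵇ2]≡not[n≤ᵇ1] (suc (suc zero)) _ = refl
      n≤2⇒[n≡ᵇ2]≡not[n≤ᵇ1] (suc (suc (suc _))) (s≤s (s≤s ()))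

    semiSplayStep≡null⇒Stuck : ∀ x → IsNode t x → semiSplayStep F ex t x ≡ null →
      Stuck (pointAt F ex t x ∷ ancestorPoints x) (pointAt F ex t [])
    semiSplayStep≡null⇒Stuck [] _ _ = depth0
    semiSplayStep≡null⇒Stuck (_ ∷ []) _ _ = depth1
    semiSplayStep≡null⇒Stuck (_ ∷ _ ∷ []) _ h = depth2 (∧≡false⇒ (proj₁ (guard≡false (λ ()) h)))
    semiSplayStep≡null⇒Stuck (d ∷ e ∷ f ∷ gg) x∈t h =
      let not-both , no-rotation , p-null = semiSplayStep≡null-guards d e f gg h
          p∈t = IsNode-parent d (e ∷ f ∷ gg) x∈t
          g∈t = IsNode-parent e (f ∷ gg) p∈t
      in deeper (∧≡false⇒ not-both)
           (not∧[not∨]≡false⇒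
             (subst₂ (λ u v → (u ∧ (v ∨ pointAt F ex t gg)) ≡ false)
                     (pathAt≡not-pointAt (e ∷ f ∷ gg) p∈t) (pathAt≡not-pointAt (f ∷ gg) g∈t)
                     no-rotation))
           (semiSplayStep≡null⇒Stuck (e ∷ f ∷ gg) p∈t p-null)

lemma5p3 : (F : List Edge) (ex : ℕ → Bool) (t : TT) →
    IsForest F → TopTreeOf F ex t → OrientationInvariant F ex t →
    (x : Pos) → IsNode t x →
    semiSplayStep F ex t x ≡ null →
      (rotations F ex (semiSplayStep F ex t x) ≡ [])
      × (depth x ≤ 4)
      × (∀ s → sub t x ≡ just s → PointCluster F ex s → depth x ≤ 3)
      × (PointCluster F ex t → depth x ≤ 2)
      × (∀ s → sub t x ≡ just s → PointCluster F ex s → PointCluster F ex t → depth x ≤ 1)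
lemma5p3 F ex t _ (_ , _ , _ , clusters) _ x x∈t step≡null =
  let ≤4 , x-point⇒≤3 , root-point⇒≤2 , both⇒≤1 = bounds in
    cong (rotations F ex) step≡null
  , ≤4
  , (λ s x↦s s-point → x-point⇒≤3 (pointAt≡true F ex t x x↦s s-point))
  , (λ t-point → root-point⇒≤2 (pointAt≡true F ex t [] refl t-point))
  , (λ s x↦s s-point t-point →
       both⇒≤1 (pointAt≡true F ex t x x↦s s-point) (pointAt≡true F ex t [] refl t-point))
  where
  valid : ∀ p s → sub t p ≡ just s → Valid F ex s
  valid p s p↦s = proj₂ (clusters p s p↦s)

  bounds : DepthBounds (depth x) (pointAt F ex t x) (pointAt F ex t [])
  bounds = subst (λ n → DepthBounds n (pointAt F ex t x) (pointAt F ex t []))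
                 (length-ancestorPoints F ex t x)
                 (Stuck⇒DepthBounds (semiSplayStep≡null⇒Stuck F ex t valid x x∈t step≡null))
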